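{- Let $\mathcal F\subseteq\mathcal P([n])$ be a diamond-saturated family with $\emptyset,[n]\notin\mathcal F$, let $\mathcal A$ be its set of minimal elements, and let $a_1,\dots,a_k$, $\mathcal A_1\supsetneq\dots\supsetneq\mathcal A_k$ and $A_1,\dots,A_k$ be obtained by the construction described in the context (for any admissible choices). Then for every $1\leq i\leq k$ there exists $X_i\in\mathcal A$ such that $X_i\cap(A_1\cup A_2\cup\dots\cup A_i)=A_i$.
   Context: $\mathcal P([n])$ is the power set of $[n]=\{1,\dots,n\}$ ordered by inclusion. A diamond is four distinct sets $D,P,Q,T$ with $D\subsetneq P\subsetneq T$, $D\subsetneq Q\subsetneq T$, $P,Q$ incomparable; $\mathcal F$ is diamond-saturated if it contains no diamond but $\mathcal F\cup\{S\}$ contains one for every $S\in\mathcal P([n])\setminus\mathcal F$. For a family $\mathcal G\subseteq\mathcal P([n])$ and $i\in[n]$ let $f(i,\mathcal G)=\{G\in\mathcal G:i\in G\}$ and $W(\mathcal G)=\{i\in[n]:f(i,\mathcal G)=\emptyset\}$. Construction: set $\mathcal A_1=\mathcal A$. For $i\geq1$, if $\mathcal A_i\neq\emptyset$ choose $a_i\in[n]\setminus W(\mathcal A_i)$ such that $f(a_i,\mathcal A_i)$ is an inclusion-minimal element of $\{f(j,\mathcal A_i):j\in[n]\setminus W(\mathcal A_i)\}$, and set $\mathcal A_{i+1}=\mathcal A_i\setminus f(a_i,\mathcal A_i)$; let $k$ be the last index with $\mathcal A_k\neq\emptyset$. For $1\leq i\leq k$ let $A_i=\{j\in[n]:f(j,\mathcal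 A_i)=f(a_i,\mathcal A_i)\}$. -}

module Defs where

open import Level using (0ℓ)
open import Data.Nat using (ℕ; zero; suc; _≤_)
open import Data.Fin using (Fin)
open import Data.Bool using (Bool; true)
open import Data.Product using (Σ; ∃; _×_; _,_)
open import Data.Sum using (_⊎_)
open import Relation.Nullary using (¬_)
open import Relation.Binary.PropositionalEquality using (_≡_; _≢_)
open import Data.Fin.Subset as S using (Subset; _∈_)
open import Relation.Unary as U using (Pred; Satisfiable; Empty; _≐_)

-- A subset of [n] = {1..n} is a `Subset n` (element i of [n] is a `Fin n`).
-- A family F ⊆ P([n]) is given by its characteristic function.
Family : ℕ → Set
Family n = Subset n → Bool

_∈F_ : ∀ {n} → Subset n → Family n → Set
X ∈F ℱ = ℱ X ≡ true

SetFam : ℕ → Set₁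
SetFam n = Pred (Subset n) 0ℓ

_⊊_ : ∀ {n} → Subset n → Subset n → Set
X ⊊ Y = X S.⊆ Y × X ≢ Y

-- the family 𝒢 contains a diamond D ⊊ P ⊊ T, D ⊊ Q ⊊ T, P, Q incomparable
-- (these conditions force D, P, Q, T to be four distinct sets)
HasDiamond : ∀ {n} → SetFam n → Set
HasDiamond {n} 𝒢 =
  Σ (Subset n) λ D → Σ (Subset n) λ P → Σ (Subset n) λ Q → Σ (Subset n) λ T →
    𝒢 D × 𝒢 P × 𝒢 Q × 𝒢 T ×
    D ⊊ P × P ⊊ T × D ⊊ Q × Q ⊊ T ×
    ¬ (P S.⊆ Q) × ¬ (Q S.⊆ P)

⟦_⟧ : ∀ {n} → Family n → SetFam n
⟦ ℱ ⟧ X = X ∈F ℱ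

DiamondSaturated : ∀ {n} → Family n → Set
DiamondSaturated {n} ℱ =
  ¬ HasDiamond ⟦ ℱ ⟧ ×
  ((S : Subset n) → ¬ (S ∈F ℱ) → HasDiamond (λ X → X ∈F ℱ ⊎ X ≡ S))

Minimal : ∀ {n} → Family n → SetFam n
Minimal {n} ℱ X = X ∈F ℱ × ((Y : Subset n) → Y ∈F ℱ → ¬ (Y ⊊ X))

f : ∀ {n} → Fin n → SetFam n → SetFam n
f i 𝒢 G = 𝒢 G × i ∈ G

-- i ∈ [n] ∖ W(𝒢), i.e. f(i, 𝒢) ≠ ∅
NotInW : ∀ {n} → Fin n → SetFam n → Set
NotInW i 𝒢 = Satisfiable (f i 𝒢)

-- The sequence 𝒜_1, 𝒜_2, … determined by ℱ and a choice sequence a (a i = a_i),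
-- indexed from 1: 𝒜_1 = minimal elements of ℱ, 𝒜_{i+1} = 𝒜_i ∖ f(a_i, 𝒜_i).
-- (Index 0 is unused; we set it equal to 𝒜_1.)
𝒜seq : ∀ {n} → Family n → (ℕ → Fin n) → ℕ → SetFam n
𝒜seq ℱ a zero = Minimal ℱ
𝒜seq ℱ a (suc zero) = Minimal ℱ
𝒜seq ℱ a (suc (suc i)) = 𝒜seq ℱ a (suc i) U.∖ f (a (suc i)) (𝒜seq ℱ a (suc i))

AdmissibleRun : ∀ {n} → Family n → (ℕ → Fin n) → ℕ → Set
AdmissibleRun {n} ℱ a k =
  ((i : ℕ) → 1 ≤ i → i ≤ k →
     Satisfiable (𝒜seq ℱ a i) ×
     NotInW (a i) (𝒜seq ℱ a i) ×
     ((j : Fin n) → NotInW j (𝒜seq ℱ a i) →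
        f j (𝒜seq ℱ a i) U.⊆ f (a i) (𝒜seq ℱ a i) →
        f (a i) (𝒜seq ℱ a i) U.⊆ f j (𝒜seq ℱ a i))) ×
  Empty (𝒜seq ℱ a (suc k))

Aset : ∀ {n} → Family n → (ℕ → Fin n) → ℕ → Pred (Fin n) 0ℓ
Aset ℱ a i j = f j (𝒜seq ℱ a i) ≐ f (a i) (𝒜seq ℱ a i)

AUnion : ∀ {n} → Family n → (ℕ → Fin n) → ℕ → Pred (Fin n) 0ℓ
AUnion ℱ a i j = ∃ λ l → 1 ≤ l × l ≤ i × Aset ℱ a l j

⟪_⟫ : ∀ {n} → Subset n → Pred (Fin n) 0ℓ
⟪ X ⟫ j = j ∈ X

{-# OPTIONS --safe #-}
module Submission where

-- Pick any X ∈ f(a_i, 𝒜_i).  Then X is a minimal element of ℱ, since 𝒜_i ⊆ 𝒜_1.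
-- Every j ∈ A_i lies in X because f(j, 𝒜_i) = f(a_i, 𝒜_i) ∋ X.  Conversely, if
-- j ∈ X ∩ A_l with l < i, then X ∈ f(j, 𝒜_l) = f(a_l, 𝒜_l), a family removed when
-- passing to 𝒜_{l+1} ⊇ 𝒜_i, contradicting X ∈ 𝒜_i.

open import Defs
open import Data.Nat using (ℕ; _≤_; _<_; zero; suc; z≤n; s≤s; _≤′_; ≤′-refl; ≤′-step)
open import Data.Nat.Properties using (≤⇒≤′; m≤n⇒m<n∨m≡n; ≤-refl)
open import Data.Fin using (Fin)
open import Data.Product using (Σ; _×_; _,_; proj₁; proj₂)
open import Data.Sum using (inj₁; inj₂)
open import Data.Empty using (⊥-elim)
open import Relation.Nullary using (¬_)
open import Relation.Binary.PropositionalEquality using (refl)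
open import Data.Fin.Subset using (Subset; ⊥; ⊤; _∉_)
open import Relation.Unary using (_∩_; _≐_; _⊆_)

module _ {n : ℕ} (ℱ : Family n) (a : ℕ → Fin n) where

  𝒜seq-suc⊆ : ∀ i → 𝒜seq ℱ a (suc i) ⊆ 𝒜seq ℱ a i
  𝒜seq-suc⊆ zero    X∈𝒜 = X∈𝒜
  𝒜seq-suc⊆ (suc i) X∈𝒜 = proj₁ X∈𝒜

  𝒜seq-antitone′ : ∀ {l i} → l ≤′ i → 𝒜seq ℱ a i ⊆ 𝒜seq ℱ a l
  𝒜seq-antitone′ ≤′-refl        X∈𝒜 = X∈𝒜
  𝒜seq-antitone′ (≤′-step {i} p) X∈𝒜 = 𝒜seq-antitone′ p (𝒜seq-suc⊆ i X∈𝒜)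

  𝒜seq-antitone : ∀ {l i} → l ≤ i → 𝒜seq ℱ a i ⊆ 𝒜seq ℱ a l
  𝒜seq-antitone l≤i = 𝒜seq-antitone′ (≤⇒≤′ l≤i)

  𝒜seq⊆Minimal : ∀ i → 𝒜seq ℱ a i ⊆ Minimal ℱ
  𝒜seq⊆Minimal i = 𝒜seq-antitone {0} {i} z≤n

  -- 1 ≤ l is needed: 𝒜_1 = 𝒜_0, so nothing is removed at index 0.
  𝒜seq-avoids-Aset : ∀ {l i X j} → 1 ≤ l → l < i →
                     𝒜seq ℱ a i X → Aset ℱ a l j → j ∉ X
  𝒜seq-avoids-Aset {suc l} (s≤s _) l<i X∈𝒜ᵢ (j→aₗ , _) j∈X
    with 𝒜seq-antitone {suc (suc l)} l<i X∈𝒜ᵢ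
  ... | X∈𝒜ₗ , X∉f = X∉f (j→aₗ (X∈𝒜ₗ , j∈X))

  Aset⊆ : ∀ {i X} → f (a i) (𝒜seq ℱ a i) X → Aset ℱ a i ⊆ ⟪ X ⟫
  Aset⊆ X∈f (_ , aᵢ→j) = proj₂ (aᵢ→j X∈f)

  ∩AUnion≐Aset : ∀ {i X} → 1 ≤ i → f (a i) (𝒜seq ℱ a i) X →
                 (⟪ X ⟫ ∩ AUnion ℱ a i) ≐ Aset ℱ a i
  ∩AUnion≐Aset {i} {X} 1≤i X∈f@(X∈𝒜ᵢ , _) = ∩AUnion⊆Aset , Aset⊆∩AUnion
    where
    ∩AUnion⊆Aset : (⟪ X ⟫ ∩ AUnion ℱ a i) ⊆ Aset ℱ a i
    ∩AUnion⊆Aset (j∈X , l , 1≤l , l≤i , j∈Aₗ) with m≤n⇒m<n∨m≡n l≤i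
    ... | inj₁ l<i  = ⊥-elim (𝒜seq-avoids-Aset 1≤l l<i X∈𝒜ᵢ j∈Aₗ j∈X)
    ... | inj₂ refl = j∈Aₗ

    Aset⊆∩AUnion : Aset ℱ a i ⊆ (⟪ X ⟫ ∩ AUnion ℱ a i)
    Aset⊆∩AUnion j∈Aᵢ = Aset⊆ X∈f j∈Aᵢ , i , 1≤i , ≤-refl , j∈Aᵢ

proposition3p3 : (n : ℕ) (ℱ : Family n) → DiamondSaturated ℱ →
    ¬ (⊥ ∈F ℱ) → ¬ (⊤ ∈F ℱ) →
    (a : ℕ → Fin n) (k : ℕ) → AdmissibleRun ℱ a k →
    (i : ℕ) → 1 ≤ i → i ≤ k →
    Σ (Subset n) λ X → Minimal ℱ X × ((⟪ X ⟫ ∩ AUnion ℱ a i) ≐ Aset ℱ a i)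
proposition3p3 n ℱ _ _ _ a k (run , _) i 1≤i i≤k =
  let (X , X∈f) = proj₁ (proj₂ (run i 1≤i i≤k))
  in X , 𝒜seq⊆Minimal ℱ a i (proj₁ X∈f) , ∩AUnion≐Aset ℱ a 1≤i X∈f
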